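{- Let $a_{ij}$ ($i,j\ge1$, $|i-j|\le1$) be non-commuting indeterminates, and set $a_{ij}=0$ when $|i-j|>1$. Give each diagonal variable $a_{ii}$ degree $2$ and each off-diagonal variable $a_{i,i\pm1}$ degree $1$. Let $$F=1+\sum a_{i_0i_1}a_{i_1i_2}\cdots a_{i_{m-1}i_m},$$ the sum over all $m\ge1$ and all sequences $(i_0,i_1,\dots,i_m)$ of positive integers with $i_0=i_m=1$ and $|i_r-i_{r+1}|\le 1$ for all $r$, and write $F=1+\sum_{n\ge1}t_n$ with $t_n$ homogeneous of degree $2n$. Then for each $n\ge1$ the number of monomials of $t_n$ is the $n$-th large Schröder number $r_n$.
   Context: $F$ is the inverse $|T|_{11}^{ -1}$ of the $(1,1)$ quasideterminant of $T=I-A$, where $A=(a_{ij})$ is the infinite Jacobi matrix. The large Schröder numbers $r_n$ ($r_0=1,r_1=2,r_2=6,r_3=22,r_4=90,\dots$; OEIS A006318) count lattice paths from $(0,0)$ to $(n,n)$ using steps $(1,0)$, $(0,1)$, $(1,1)$ that never go above the diagonal. For example, $t_1=a_{11}+a_{12}a_{21}$. -}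

module Defs where

open import Data.Nat using (ℕ; zero; suc; _+_; _*_; _≤_; ∣_-_∣; _≡ᵇ_)
open import Data.Bool using (if_then_else_)
open import Data.Product using (_×_; _,_; proj₁; proj₂; Σ)
open import Data.List using (List; []; _∷_; _++_; [_]; inits)
open import Data.List.Relation.Unary.All using (All)
open import Data.List.Relation.Unary.Linked using (Linked)
open import Relation.Binary.PropositionalEquality using (_≡_)

-- A monomial in the non-commuting indeterminates is a word, i.e. a list
-- of indeterminates (equality of monomials = equality of words).
Var : Set
Var = ℕ × ℕ

Monomial : Set
Monomial = List Var

degVar : Var → ℕ
degVar (i , j) = if i ≡ᵇ j then 2 else 1

deg : Monomial → ℕ
deg []      = 0
deg (v ∷ w) = degVar v + deg w

word : List ℕ → Monomial
word (a ∷ b ∷ r) = (a , b) ∷ word (b ∷ r)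
word _           = []

-- An admissible index sequence (i_0,...,i_m), m ≥ 1, i_0 = i_m = 1,
-- all i_r positive, |i_r - i_{r+1}| ≤ 1.  It is written as
-- 1 ∷ mid ++ [ 1 ], so that m = length mid + 1 ≥ 1 automatically.
indexSeq : List ℕ → List ℕ
indexSeq mid = 1 ∷ (mid ++ [ 1 ])

Admissible : List ℕ → Set
Admissible mid =
  All (λ i → 1 ≤ i) mid × Linked (λ a b → ∣ a - b ∣ ≤ 1) (indexSeq mid)

-- F = 1 + Σ (words of admissible sequences); every admissible sequence
-- contributes coefficient +1, so a word is a monomial of F - 1 iff it is the
-- word of some admissible sequence.  t_n is the degree-2n part.
MonomialOf-t : ℕ → Monomial → Set
MonomialOf-t n w =
  Σ (List ℕ) (λ mid → Admissible mid × word (indexSeq mid) ≡ w) × deg w ≡ 2 * n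

data Step : Set where
  E N D : Step

stepVec : Step → ℕ × ℕ
stepVec E = (1 , 0)
stepVec N = (0 , 1)
stepVec D = (1 , 1)

pos : List Step → ℕ × ℕ
pos []      = (0 , 0)
pos (s ∷ p) = (proj₁ (stepVec s) + proj₁ (pos p) , proj₂ (stepVec s) + proj₂ (pos p))

NeverAbove : List Step → Set
NeverAbove p = All (λ q → proj₂ (pos q) ≤ proj₁ (pos q)) (inits p)

SchroderPath : ℕ → List Step → Set
SchroderPath n p = pos p ≡ (n , n) × NeverAbove p

module Submission where

-- Both sides of the count are identified with one family of lattice walks.
--
-- Measure a point of a Schröder path by its height x − y.  A step E raises
-- the height by one, N lowers it by one, D keeps it; give E and N weight 1
-- and D weight 2.  A large Schröder path to (n , n) is then exactly a walk
-- from height 0 back to height 0, never below 0, of weight 2n.  Reading the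
-- walk as the index sequence "height + 1" turns a step at height h into the
-- indeterminate a_{h+1,h+2} (E), a_{h+1,h} (N) or a_{h+1,h+1} (D), whose
-- degree is the weight of the step; so the non-empty walks of weight 2n are
-- in bijection with the admissible index sequences of degree 2n, i.e. with
-- the monomials of t_n.

open import Defs
open import Data.Nat using (ℕ; _≤_)
open import Data.Product using (Σ; _×_)
open import Data.List using (List; length)
open import Data.List.Membership.Propositional using (_∈_)
open import Data.List.Relation.Unary.Unique.Propositional using (Unique)
open import Function.Bundles using (_⇔_)
open import Relation.Binary.PropositionalEquality using (_≡_)

open import Data.Nat using (zero; suc; _+_; _*_; pred; ∣_-_∣; z≤n; s≤s; s≤s⁻¹)
open import Data.Nat.Properties using (+-suc; +-identityʳ; suc-injective; *-cancelˡ-≡)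
open import Data.Product using (_,_; proj₁; proj₂)
open import Data.Sum using (_⊎_; inj₁; inj₂)
open import Data.List using ([]; _∷_; _++_; [_]; map; inits)
open import Data.List.Properties using (length-map; ∷-injectiveˡ; ∷-injectiveʳ)
open import Data.List.Relation.Unary.All using (All; []; _∷_)
import Data.List.Relation.Unary.All as All
import Data.List.Relation.Unary.All.Properties as All
open import Data.List.Relation.Unary.Linked using (Linked; [-]; _∷_)
open import Data.List.Relation.Unary.Any using (here)
open import Data.List.Relation.Binary.Disjoint.Propositional using (Disjoint)
open import Data.List.Membership.Propositional.Properties
  using (∈-map⁺; ∈-map⁻; ∈-++⁺ˡ; ∈-++⁺ʳ; ∈-++⁻)
import Data.List.Relation.Unary.Unique.Propositional.Properties as Unique
import Data.List.Relation.Unary.AllPairs as AllPairs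
open import Function.Bundles using (mk⇔)
open import Function.Base using (_∘_)
open import Relation.Binary.PropositionalEquality
  using (_≢_; refl; sym; trans; cong; cong₂; subst; module ≡-Reasoning)

-- 'Walk h k p': the step list p, started at height h, stays at height ≥ 0,
-- ends at height 0 and has weight k (E, N weigh 1, D weighs 2).
data Walk : ℕ → ℕ → List Step → Set where
  end   : Walk 0 0 []
  east  : ∀ {h k p} → Walk (suc h) k p → Walk h (suc k) (E ∷ p)
  north : ∀ {h k p} → Walk h k p → Walk (suc h) (suc k) (N ∷ p)
  diag  : ∀ {h k p} → Walk h k p → Walk h (suc (suc k)) (D ∷ p)

walk-nonempty : ∀ {h k p} → Walk h (suc k) p → Σ Step (λ s → Σ (List Step) (λ q → p ≡ s ∷ q))
walk-nonempty (east  {p = q} _) = E , q , refl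
walk-nonempty (north {p = q} _) = N , q , refl
walk-nonempty (diag  {p = q} _) = D , q , refl

mutual
  walks : ℕ → ℕ → List (List Step)
  walks h       (suc k) =
    map (E ∷_) (walks (suc h) k) ++ (map (N ∷_) (walksAfterN h k) ++ map (D ∷_) (walksAfterD h k))
  walks zero    zero    = [ [] ]
  walks (suc h) zero    = []

  walksAfterN : ℕ → ℕ → List (List Step)
  walksAfterN zero    k = []
  walksAfterN (suc h) k = walks h k

  walksAfterD : ℕ → ℕ → List (List Step)
  walksAfterD h zero    = []
  walksAfterD h (suc k) = walks h k

mutual
  walks-sound : ∀ h k {p} → p ∈ walks h k → Walk h k p
  walks-sound zero    zero (here refl) = end
  walks-sound h (suc k) p∈ with ∈-++⁻ (map (E ∷_) (walks (suc h) k)) p∈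
  ... | inj₁ p∈E with ∈-map⁻ (E ∷_) p∈E
  ...   | q , q∈ , refl = east (walks-sound (suc h) k q∈)
  walks-sound h (suc k) p∈ | inj₂ p∈ND with ∈-++⁻ (map (N ∷_) (walksAfterN h k)) p∈ND
  ... | inj₁ p∈N with ∈-map⁻ (N ∷_) p∈N
  ...   | q , q∈ , refl = walksAfterN-sound h k q∈
  walks-sound h (suc k) p∈ | inj₂ p∈ND | inj₂ p∈D with ∈-map⁻ (D ∷_) p∈D
  ...   | q , q∈ , refl = walksAfterD-sound h k q∈

  walksAfterN-sound : ∀ h k {q} → q ∈ walksAfterN h k → Walk h (suc k) (N ∷ q)
  walksAfterN-sound (suc h) k q∈ = north (walks-sound h k q∈)

  walksAfterD-sound : ∀ h k {q} → q ∈ walksAfterD h k → Walk h (suc k) (D ∷ q)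
  walksAfterD-sound h (suc k) q∈ = diag (walks-sound h k q∈)

walks-complete : ∀ {h k p} → Walk h k p → p ∈ walks h k
walks-complete end = here refl
walks-complete (east w) = ∈-++⁺ˡ (∈-map⁺ (E ∷_) (walks-complete w))
walks-complete (north {h} {k} w) =
  ∈-++⁺ʳ (map (E ∷_) (walks (suc (suc h)) k)) (∈-++⁺ˡ (∈-map⁺ (N ∷_) (walks-complete w)))
walks-complete (diag {h} {k} w) =
  ∈-++⁺ʳ (map (E ∷_) (walks (suc h) (suc k)))
    (∈-++⁺ʳ (map (N ∷_) (walksAfterN h (suc k))) (∈-map⁺ (D ∷_) (walks-complete w)))

prefixed-disjoint : ∀ {s t} → s ≢ t → (xs ys : List (List Step)) →
  Disjoint (map (s ∷_) xs) (map (t ∷_) ys)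
prefixed-disjoint s≢t xs ys (v∈xs , v∈ys) with ∈-map⁻ _ v∈xs | ∈-map⁻ _ v∈ys
... | _ , _ , refl | _ , _ , eq = s≢t (∷-injectiveˡ eq)

disjoint-++ : ∀ {A : Set} {xs ys zs : List A} →
  Disjoint xs ys → Disjoint xs zs → Disjoint xs (ys ++ zs)
disjoint-++ {ys = ys} xs#ys xs#zs (v∈xs , v∈ys++zs) with ∈-++⁻ ys v∈ys++zs
... | inj₁ v∈ys = xs#ys (v∈xs , v∈ys)
... | inj₂ v∈zs = xs#zs (v∈xs , v∈zs)

-- The enumeration has no repetitions: the three blocks start with different
-- steps, and prefixing a fixed step is injective.
mutual
  walks-unique : ∀ h k → Unique (walks h k)
  walks-unique zero    zero    = [] AllPairs.∷ AllPairs.[]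
  walks-unique (suc h) zero    = AllPairs.[]
  walks-unique h       (suc k) =
    Unique.++⁺ (Unique.map⁺ ∷-injectiveʳ (walks-unique (suc h) k))
      (Unique.++⁺ (Unique.map⁺ ∷-injectiveʳ (walksAfterN-unique h k))
                  (Unique.map⁺ ∷-injectiveʳ (walksAfterD-unique h k))
                  (prefixed-disjoint (λ ()) (walksAfterN h k) (walksAfterD h k)))
      (disjoint-++ (prefixed-disjoint (λ ()) (walks (suc h) k) (walksAfterN h k))
                   (prefixed-disjoint (λ ()) (walks (suc h) k) (walksAfterD h k)))

  walksAfterN-unique : ∀ h k → Unique (walksAfterN h k)
  walksAfterN-unique zero    k = AllPairs.[]
  walksAfterN-unique (suc h) k = walks-unique h k

  walksAfterD-unique : ∀ h k → Unique (walksAfterD h k)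
  walksAfterD-unique h zero    = AllPairs.[]
  walksAfterD-unique h (suc k) = walks-unique h k

X Y : List Step → ℕ
X q = proj₁ (pos q)
Y q = proj₂ (pos q)

BelowLine : ℕ → List Step → Set
BelowLine h p = All (λ q → Y q ≤ h + X q) (inits p)

slack-right : ∀ {a} h b → a ≤ suc h + b → a ≤ h + suc b
slack-right {a} h b = subst (a ≤_) (sym (+-suc h b))

slack-left : ∀ {a} h b → a ≤ h + suc b → a ≤ suc h + b
slack-left {a} h b = subst (a ≤_) (+-suc h b)

walk⇒belowLine : ∀ {h k p} → Walk h k p →
  BelowLine h p × Y p ≡ h + X p × X p + Y p ≡ k
walk⇒belowLine end = z≤n ∷ [] , refl , refl
walk⇒belowLine (east {h} {p = p} w) with walk⇒belowLine w
... | below , onLine , weight =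
  z≤n ∷ All.map⁺ (All.map (λ {q} → slack-right h (X q)) below)
  , trans onLine (sym (+-suc h (X p))) , cong suc weight
walk⇒belowLine (north {p = p} w) with walk⇒belowLine w
... | below , onLine , weight =
  z≤n ∷ All.map⁺ (All.map s≤s below)
  , cong suc onLine , trans (+-suc (X p) (Y p)) (cong suc weight)
walk⇒belowLine (diag {h} {p = p} w) with walk⇒belowLine w
... | below , onLine , weight =
  z≤n ∷ All.map⁺ (All.map (λ {q} le → slack-right h (X q) (s≤s le)) below)
  , trans (cong suc onLine) (sym (+-suc h (X p)))
  , cong suc (trans (+-suc (X p) (Y p)) (cong suc weight))

belowLine⇒walk : ∀ h p → BelowLine h p → Y p ≡ h + X p → Walk h (X p + Y p) p
belowLine⇒walk zero [] _ _ = end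
belowLine⇒walk h (E ∷ p) (_ ∷ below) onLine =
  east (belowLine⇒walk (suc h) p (All.map (λ {q} → slack-left h (X q)) (All.map⁻ below))
         (trans onLine (+-suc h (X p))))
belowLine⇒walk zero (N ∷ p) (_ ∷ () ∷ _) _
belowLine⇒walk (suc h) (N ∷ p) (_ ∷ below) onLine =
  subst (λ k → Walk (suc h) k (N ∷ p)) (sym (+-suc (X p) (Y p)))
    (north (belowLine⇒walk h p (All.map s≤s⁻¹ (All.map⁻ below)) (suc-injective onLine)))
belowLine⇒walk h (D ∷ p) (_ ∷ below) onLine =
  subst (λ k → Walk h k (D ∷ p)) (cong suc (sym (+-suc (X p) (Y p))))
    (diag (belowLine⇒walk h p (All.map (λ {q} le → s≤s⁻¹ (slack-left h (X q) le)) (All.map⁻ below))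
            (suc-injective (trans onLine (+-suc h (X p))))))

double : ∀ a → 2 * a ≡ a + a
double a = cong (a +_) (+-identityʳ a)

schroder⇒walk : ∀ m p → SchroderPath m p → Walk 0 (2 * m) p
schroder⇒walk m p (pos≡ , neverAbove) =
  subst (λ k → Walk 0 k p) weight (belowLine⇒walk 0 p neverAbove onDiagonal)
  where
  onDiagonal : Y p ≡ X p
  onDiagonal = trans (cong proj₂ pos≡) (sym (cong proj₁ pos≡))
  weight : X p + Y p ≡ 2 * m
  weight = trans (cong₂ _+_ (cong proj₁ pos≡) (cong proj₂ pos≡)) (sym (double m))

walk⇒schroder : ∀ m p → Walk 0 (2 * m) p → SchroderPath m p
walk⇒schroder m p w with walk⇒belowLine w
... | neverAbove , onDiagonal , weight = cong₂ _,_ x≡m (trans onDiagonal x≡m) , neverAbove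
  where
  open ≡-Reasoning
  x≡m : X p ≡ m
  x≡m = *-cancelˡ-≡ (X p) m 2 (begin
    2 * X p     ≡⟨ double (X p) ⟩
    X p + X p   ≡⟨ cong (X p +_) onDiagonal ⟨
    X p + Y p   ≡⟨ weight ⟩
    2 * m       ∎)

monomial : ℕ → List Step → Monomial
monomial h []      = []
monomial h (E ∷ p) = (suc h , suc (suc h)) ∷ monomial (suc h) p
monomial h (N ∷ p) = (suc h , h) ∷ monomial (pred h) p
monomial h (D ∷ p) = (suc h , suc h) ∷ monomial h p

-- The kind of step an indeterminate comes from, read off by comparing its
-- two indices; it does not depend on the height.
stepOf : Var → Step
stepOf (zero  , zero)  = D
stepOf (zero  , suc _) = E
stepOf (suc _ , zero)  = N
stepOf (suc i , suc j) = stepOf (i , j)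

stepOf-up : ∀ h → stepOf (h , suc h) ≡ E
stepOf-up zero    = refl
stepOf-up (suc h) = stepOf-up h

stepOf-down : ∀ h → stepOf (suc h , h) ≡ N
stepOf-down zero    = refl
stepOf-down (suc h) = stepOf-down h

stepOf-level : ∀ h → stepOf (h , h) ≡ D
stepOf-level zero    = refl
stepOf-level (suc h) = stepOf-level h

stepsOf-monomial : ∀ h p → map stepOf (monomial h p) ≡ p
stepsOf-monomial h []      = refl
stepsOf-monomial h (E ∷ p) = cong₂ _∷_ (stepOf-up (suc h))   (stepsOf-monomial (suc h) p)
stepsOf-monomial h (N ∷ p) = cong₂ _∷_ (stepOf-down h)       (stepsOf-monomial (pred h) p)
stepsOf-monomial h (D ∷ p) = cong₂ _∷_ (stepOf-level (suc h)) (stepsOf-monomial h p)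

monomial-injective : ∀ h {p q} → monomial h p ≡ monomial h q → p ≡ q
monomial-injective h {p} {q} eq =
  trans (sym (stepsOf-monomial h p)) (trans (cong (map stepOf) eq) (stepsOf-monomial h q))

degVar-up : ∀ h → degVar (h , suc h) ≡ 1
degVar-up zero    = refl
degVar-up (suc h) = degVar-up h

degVar-down : ∀ h → degVar (suc h , h) ≡ 1
degVar-down zero    = refl
degVar-down (suc h) = degVar-down h

degVar-level : ∀ h → degVar (h , h) ≡ 2
degVar-level zero    = refl
degVar-level (suc h) = degVar-level h

deg-monomial : ∀ {h k p} → Walk h k p → deg (monomial h p) ≡ k
deg-monomial end           = refl
deg-monomial (east  {h} w) = cong₂ _+_ (degVar-up (suc h))    (deg-monomial w)
deg-monomial (north {h} w) = cong₂ _+_ (degVar-down (suc h))  (deg-monomial w)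
deg-monomial (diag  {h} w) = cong₂ _+_ (degVar-level (suc h)) (deg-monomial w)

Adjacent : ℕ → ℕ → Set
Adjacent a b = ∣ a - b ∣ ≤ 1

AdmissibleFrom : ℕ → List ℕ → Set
AdmissibleFrom i mid = All (1 ≤_) mid × Linked Adjacent (i ∷ mid ++ [ 1 ])

adjacent-up : ∀ h → Adjacent h (suc h)
adjacent-up zero    = s≤s z≤n
adjacent-up (suc h) = adjacent-up h

adjacent-down : ∀ h → Adjacent (suc h) h
adjacent-down zero    = s≤s z≤n
adjacent-down (suc h) = adjacent-down h

adjacent-level : ∀ h → Adjacent h h
adjacent-level zero    = z≤n
adjacent-level (suc h) = adjacent-level h

adjacent-cases : ∀ h m → Adjacent h m → m ≡ suc h ⊎ m ≡ h ⊎ h ≡ suc m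
adjacent-cases zero          zero          _  = inj₂ (inj₁ refl)
adjacent-cases zero          (suc zero)    _  = inj₁ refl
adjacent-cases (suc zero)    zero          _  = inj₂ (inj₂ refl)
adjacent-cases zero          (suc (suc _)) (s≤s ())
adjacent-cases (suc (suc _)) zero          (s≤s ())
adjacent-cases (suc h)       (suc m)       le with adjacent-cases h m le
... | inj₁ eq        = inj₁ (cong suc eq)
... | inj₂ (inj₁ eq) = inj₂ (inj₁ (cong suc eq))
... | inj₂ (inj₂ eq) = inj₂ (inj₂ (cong suc eq))

walk⇒admissible : ∀ {h k s p} → Walk h k (s ∷ p) → Σ (List ℕ) (λ mid →
  AdmissibleFrom (suc h) mid × word (suc h ∷ mid ++ [ 1 ]) ≡ monomial h (s ∷ p))
walk⇒admissible (north {p = []} end) = [] , ([] , s≤s z≤n ∷ [-]) , refl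
walk⇒admissible (diag  {p = []} end) = [] , ([] , z≤n ∷ [-]) , refl
walk⇒admissible (east {h} {p = _ ∷ _} w) with walk⇒admissible w
... | mid , (positive , adj) , eq =
  suc (suc h) ∷ mid , (s≤s z≤n ∷ positive , adjacent-up (suc h) ∷ adj) , cong (_ ∷_) eq
walk⇒admissible (north {h} {p = _ ∷ _} w) with walk⇒admissible w
... | mid , (positive , adj) , eq =
  suc h ∷ mid , (s≤s z≤n ∷ positive , adjacent-down (suc h) ∷ adj) , cong (_ ∷_) eq
walk⇒admissible (diag {h} {p = _ ∷ _} w) with walk⇒admissible w
... | mid , (positive , adj) , eq =
  suc h ∷ mid , (s≤s z≤n ∷ positive , adjacent-level (suc h) ∷ adj) , cong (_ ∷_) eq

admissible⇒walk : ∀ h mid → AdmissibleFrom (suc h) mid → Σ (List Step) (λ p →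
  Σ ℕ (λ k → Walk h k p × monomial h p ≡ word (suc h ∷ mid ++ [ 1 ])))
admissible⇒walk zero       [] _ = D ∷ [] , 2 , diag end , refl
admissible⇒walk (suc zero) [] _ = N ∷ [] , 1 , north end , refl
admissible⇒walk (suc (suc h)) [] (_ , s≤s () ∷ _)
admissible⇒walk h (suc m ∷ mid) (_ ∷ positive , adj ∷ adjs) with adjacent-cases h m adj
... | inj₁ refl with admissible⇒walk (suc h) mid (positive , adjs)
...   | p , k , w , eq = E ∷ p , suc k , east w , cong (_ ∷_) eq
admissible⇒walk h (suc m ∷ mid) (_ ∷ positive , adj ∷ adjs) | inj₂ (inj₁ refl)
  with admissible⇒walk h mid (positive , adjs)
...   | p , k , w , eq = D ∷ p , suc (suc k) , diag w , cong (_ ∷_) eq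
admissible⇒walk h (suc m ∷ mid) (_ ∷ positive , adj ∷ adjs) | inj₂ (inj₂ refl)
  with admissible⇒walk m mid (positive , adjs)
...   | p , k , w , eq = N ∷ p , suc k , north w , cong (_ ∷_) eq

-- The monomials of t_n are exactly the monomials of walks from 0 of
-- weight 2n, for n ≥ 1 (positive weight excludes the empty walk).
walk⇒monomialOf-t : ∀ m {p} → Walk 0 (2 * suc m) p → MonomialOf-t (suc m) (monomial 0 p)
walk⇒monomialOf-t m w with walk-nonempty w
... | _ , _ , refl with walk⇒admissible w
...   | mid , admissible , eq = (mid , admissible , eq) , deg-monomial w

monomialOf-t⇒walk : ∀ n {v} → MonomialOf-t n v →
  Σ (List Step) (λ p → Walk 0 (2 * n) p × monomial 0 p ≡ v)
monomialOf-t⇒walk n ((mid , admissible , refl) , deg≡) with admissible⇒walk 0 mid admissible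
... | p , k , w , eq =
  p , subst (λ j → Walk 0 j p) (trans (sym (deg-monomial w)) (trans (cong deg eq) deg≡)) w , eq

proposition8 : (n : ℕ) → 1 ≤ n →
    Σ (List Monomial) (λ L → Σ (List (List Step)) (λ S →
    Unique L × Unique S ×
    ((w : Monomial) → (w ∈ L) ⇔ MonomialOf-t n w) ×
    ((p : List Step) → (p ∈ S) ⇔ SchroderPath n p) ×
    length L ≡ length S))
proposition8 (suc m) _ =
  map (monomial 0) S , S
  , Unique.map⁺ (monomial-injective 0) (walks-unique 0 (2 * suc m)) , walks-unique 0 (2 * suc m)
  , (λ v → mk⇔ listed⇒monomialOf-t monomialOf-t⇒listed)
  , (λ p → mk⇔ (walk⇒schroder (suc m) p ∘ walks-sound 0 (2 * suc m))
               (walks-complete ∘ schroder⇒walk (suc m) p))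
  , length-map (monomial 0) S
  where
  S : List (List Step)
  S = walks 0 (2 * suc m)

  listed⇒monomialOf-t : ∀ {v} → v ∈ map (monomial 0) S → MonomialOf-t (suc m) v
  listed⇒monomialOf-t v∈ with ∈-map⁻ (monomial 0) v∈
  ... | p , p∈ , refl = walk⇒monomialOf-t m (walks-sound 0 (2 * suc m) p∈)

  monomialOf-t⇒listed : ∀ {v} → MonomialOf-t (suc m) v → v ∈ map (monomial 0) S
  monomialOf-t⇒listed t with monomialOf-t⇒walk (suc m) t
  ... | p , w , refl = ∈-map⁺ (monomial 0) (walks-complete w)
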